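{- Let $k,\ell$ be integers with $2\le k\le\ell$. Suppose $G=(V,E)$ is a graph that admits a bipartition $V=A\cup B$ (with $A$ and $B$ independent sets) with $|A|<R(k,\ell)$. Then $G$ is $(k,\ell)$-choosable.
   Context: Let $[\ell]=\{1,\dots,\ell\}$ and $\binom{[\ell]}{k}$ the set of $k$-element subsets of $[\ell]$. A family $\mathcal F\subseteq\binom{[\ell]}{k}$ has Property K$(k,\ell)$ if there exists a set $K\in\binom{[\ell]}{k-1}$ that intersects every set in $\mathcal F$. $R(k,\ell)$ is the cardinality of a smallest family $\mathcal F\subseteq\binom{[\ell]}{k}$ that does not have Property K$(k,\ell)$ ($R(k,\ell)=\infty$ if no such family exists). A $(k,\ell)$-list-assignment of $G$ is a map $L:V\to\binom{[\ell]}{k}$; $G$ is $(k,\ell)$-choosable if for every such $L$ there is a proper vertex colouring $c$ with $c(v)\in L(v)$ for all $v\in V$. -}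

module Defs where

open import Data.Nat using (ℕ; _<_; _∸_)
open import Data.Bool using (Bool; true; false)
open import Data.Fin using (Fin)
open import Data.Fin.Subset using (Subset; _∈_; _∉_; _∩_; ∣_∣; Nonempty)
open import Data.List using (List; length)
open import Data.List.Membership.Propositional using () renaming (_∈_ to _∈ₗ_)
open import Data.List.Relation.Unary.All using (All)
open import Data.List.Relation.Unary.Unique.Propositional using (Unique)
open import Data.Product using (Σ; _×_; ∃; _,_)
open import Relation.Binary.PropositionalEquality using (_≡_; _≢_)
open import Relation.Nullary using (¬_)
open import Data.Empty using (⊥)

IsKSubset : (k ℓ : ℕ) → Subset ℓ → Set
IsKSubset k ℓ S = ∣ S ∣ ≡ k

-- A family F ⊆ binom([ℓ],k): a duplicate-free list of k-subsets of [ℓ];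
-- its cardinality is its length.
record Family (k ℓ : ℕ) : Set where
  field
    sets     : List (Subset ℓ)
    distinct : Unique sets
    sized    : All (IsKSubset k ℓ) sets

open Family public

card : ∀ {k ℓ} → Family k ℓ → ℕ
card F = length (sets F)

PropertyK : (k ℓ : ℕ) → Family k ℓ → Set
PropertyK k ℓ F =
  Σ (Subset ℓ) λ K → (∣ K ∣ ≡ k ∸ 1) × (∀ S → S ∈ₗ sets F → Nonempty (K ∩ S))

-- n < R(k,ℓ), where R(k,ℓ) is the minimum cardinality of a family without
-- Property K (∞ if there is none): i.e. every family without Property K
-- has cardinality > n.
_<R[_,_] : ℕ → ℕ → ℕ → Set
n <R[ k , ℓ ] = (F : Family k ℓ) → ¬ PropertyK k ℓ F → n < card F

record Graph (n : ℕ) : Set where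
  field
    adj     : Fin n → Fin n → Bool
    symm    : ∀ u v → adj u v ≡ adj v u
    irrefl  : ∀ v → adj v v ≡ false

open Graph public

Edge : ∀ {n} → Graph n → Fin n → Fin n → Set
Edge G u v = adj G u v ≡ true

-- A is one side of a bipartition V = A ∪ B with B = V \ A; both independent
IsBipartition : ∀ {n} → Graph n → Subset n → Set
IsBipartition G A =
  (∀ u v → Edge G u v → u ∈ A → v ∈ A → ⊥) ×
  (∀ u v → Edge G u v → u ∉ A → v ∉ A → ⊥)

ListAssignment : (k ℓ n : ℕ) → Set
ListAssignment k ℓ n = Σ (Fin n → Subset ℓ) λ L → ∀ v → ∣ L v ∣ ≡ k

ProperLColouring : ∀ {k ℓ n} → Graph n → ListAssignment k ℓ n → (Fin n → Fin ℓ) → Set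
ProperLColouring {k} {ℓ} {n} G (L , _) c =
  (∀ v → c v ∈ L v) × (∀ u v → Edge G u v → c u ≢ c v)

Choosable : (k ℓ : ℕ) → ∀ {n} → Graph n → Set
Choosable k ℓ {n} G =
  (L : ListAssignment k ℓ n) → Σ (Fin n → Fin ℓ) λ c → ProperLColouring G L c

-- Since |A| < R(k,ℓ), the lists of the vertices of A form a family with
-- Property K: some (k-1)-set K of colours meets every list on A. Colour each
-- vertex of A from K and each vertex of B from outside K, which is possible
-- because its list has k > |K| colours. Adjacent vertices lie on different
-- sides of the bipartition, so their colours lie on different sides of K.
module Submission where

open import Defs
open import Data.Nat using (ℕ; _≤_; _<_; _∸_; _≟_; suc; s≤s)
open import Data.Nat.Properties using (≤-refl; ≤-trans; <⇒≤; <⇒≱; ≤-reflexive)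
open import Data.Bool using (true; false)
import Data.Bool as Bool
open import Data.Fin using (Fin) renaming (zero to fzero; suc to fsuc)
open import Data.Fin.Properties using (any?)
open import Data.Fin.Subset using (Subset; ∣_∣; _∈_; _∉_; _∩_; _⊆_; Nonempty)
open import Data.Fin.Subset.Properties
  using (_∈?_; nonempty?; anySubset?; p⊆q⇒∣p∣≤∣q∣; x∈p∩q⁻)
open import Data.Vec using ([]; _∷_; here; there)
open import Data.Vec.Properties using (≡-dec)
open import Data.List using (List; []; _∷_; map; length; deduplicate)
open import Data.List.Properties using (length-map; length-deduplicate)
open import Data.List.Membership.Propositional using () renaming (_∈_ to _∈ₗ_)
open import Data.List.Membership.Propositional.Properties using (∈-map⁺; ∈-deduplicate⁺)
open import Data.List.Relation.Unary.Any using () renaming (here to hereₗ; there to thereₗ)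
open import Data.List.Relation.Unary.All as All using (All)
open import Data.List.Relation.Unary.All.Properties using (map⁺; deduplicate⁺)
open import Data.List.Relation.Unary.Unique.DecPropositional.Properties using (deduplicate-!)
open import Data.Product using (Σ; ∃; _×_; _,_; proj₁; proj₂)
open import Function.Bundles using (_⇔_; mk⇔; Equivalence)
open import Relation.Binary.Definitions using (DecidableEquality)
open import Relation.Binary.PropositionalEquality using (_≡_; _≢_; refl; cong; sym; trans; subst; subst₂)
open import Relation.Nullary using (Dec; yes; no; ¬?; contradiction)
open import Relation.Nullary.Decidable using (map′; _×-dec_)

elements : ∀ {n} → Subset n → List (Fin n)
elements []          = []
elements (true  ∷ p) = fzero ∷ map fsuc (elements p)
elements (false ∷ p) = map fsuc (elements p)

length-elements : ∀ {n} (p : Subset n) → length (elements p) ≡ ∣ p ∣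
length-elements []          = refl
length-elements (true  ∷ p) = cong suc (trans (length-map fsuc (elements p)) (length-elements p))
length-elements (false ∷ p) = trans (length-map fsuc (elements p)) (length-elements p)

∈-elements : ∀ {n} {x : Fin n} (p : Subset n) → x ∈ p → x ∈ₗ elements p
∈-elements (true  ∷ p) here       = hereₗ refl
∈-elements (true  ∷ p) (there x∈) = thereₗ (∈-map⁺ fsuc (∈-elements p x∈))
∈-elements (false ∷ p) (there x∈) = ∈-map⁺ fsuc (∈-elements p x∈)

∣p∣<∣q∣⇒∃x∈q∖p : ∀ {n} {p q : Subset n} → ∣ p ∣ < ∣ q ∣ → ∃ λ x → x ∈ q × x ∉ p
∣p∣<∣q∣⇒∃x∈q∖p {p = p} {q} ∣p∣<∣q∣ with any? (λ x → x ∈? q ×-dec ¬? (x ∈? p))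
... | yes x∈q∖p = x∈q∖p
... | no  q∖p-empty = contradiction (p⊆q⇒∣p∣≤∣q∣ q⊆p) (<⇒≱ ∣p∣<∣q∣)
  where
  q⊆p : q ⊆ p
  q⊆p {x} x∈q with x ∈? p
  ... | yes x∈p = x∈p
  ... | no  x∉p = contradiction (x , x∈q , x∉p) q∖p-empty

_≟ₛ_ : ∀ {ℓ} → DecidableEquality (Subset ℓ)
_≟ₛ_ = ≡-dec Bool._≟_

familyOf : ∀ {k ℓ} (xs : List (Subset ℓ)) → All (IsKSubset k ℓ) xs → Family k ℓ
familyOf xs sized-xs = record
  { sets     = deduplicate _≟ₛ_ xs
  ; distinct = deduplicate-! _≟ₛ_ xs
  ; sized    = deduplicate⁺ _≟ₛ_ sized-xs
  }

card-familyOf : ∀ {k ℓ} (xs : List (Subset ℓ)) (sized-xs : All (IsKSubset k ℓ) xs) →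
                card (familyOf xs sized-xs) ≤ length xs
card-familyOf xs _ = length-deduplicate _≟ₛ_ xs

propertyK? : ∀ {k ℓ} (F : Family k ℓ) → Dec (PropertyK k ℓ F)
propertyK? {k} F =
  map′ (λ (K , ∣K∣ , meets) → K , ∣K∣ , λ _ → All.lookup meets)
       (λ (K , ∣K∣ , meets) → K , ∣K∣ , All.tabulate (meets _))
       (anySubset? λ K → ∣ K ∣ ≟ k ∸ 1 ×-dec All.all? (λ S → nonempty? (K ∩ S)) (sets F))

<R⇒PropertyK : ∀ {m k ℓ} → m <R[ k , ℓ ] → (F : Family k ℓ) → card F ≤ m → PropertyK k ℓ F
<R⇒PropertyK small F card≤m with propertyK? F
... | yes hasK = hasK
... | no  ¬hasK = contradiction card≤m (<⇒≱ (small F ¬hasK))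

transversal : ∀ {k ℓ n} (L : ListAssignment k ℓ n) (A : Subset n) → ∣ A ∣ <R[ k , ℓ ] →
              Σ (Subset ℓ) λ K → ∣ K ∣ ≡ k ∸ 1 × (∀ v → v ∈ A → Nonempty (K ∩ proj₁ L v))
transversal {k} {ℓ} (L , ∣L∣≡k) A small =
  let (K , ∣K∣ , meets) = <R⇒PropertyK small (familyOf listsOnA listsSized) card≤∣A∣
  in  K , ∣K∣ , λ v v∈A → meets (L v) (∈-deduplicate⁺ _≟ₛ_ (∈-map⁺ L (∈-elements A v∈A)))
  where
  listsOnA : List (Subset ℓ)
  listsOnA = map L (elements A)

  listsSized : All (IsKSubset k ℓ) listsOnA
  listsSized = map⁺ (All.universal ∣L∣≡k (elements A))

  card≤∣A∣ : card (familyOf listsOnA listsSized) ≤ ∣ A ∣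
  card≤∣A∣ = ≤-trans (card-familyOf listsOnA listsSized)
                     (≤-reflexive (trans (length-map L (elements A)) (length-elements A)))

coloursOnSides : ∀ {k ℓ n} (A : Subset n) (L : ListAssignment k ℓ n) (K : Subset ℓ) →
                 (∀ v → v ∈ A → Nonempty (K ∩ proj₁ L v)) → (∀ v → ∣ K ∣ < ∣ proj₁ L v ∣) →
                 ∀ v → Σ (Fin ℓ) λ x → x ∈ proj₁ L v × (x ∈ K ⇔ v ∈ A)
coloursOnSides A (L , _) K meets ∣K∣<∣L∣ v with v ∈? A
... | yes v∈A = let (x , x∈K∩L) = meets v v∈A
                    (x∈K , x∈L) = x∈p∩q⁻ K (L v) x∈K∩L
                in  x , x∈L , mk⇔ (λ _ → v∈A) (λ _ → x∈K)
... | no  v∉A = let (x , x∈L , x∉K) = ∣p∣<∣q∣⇒∃x∈q∖p (∣K∣<∣L∣ v)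
                in  x , x∈L , mk⇔ (λ x∈K → contradiction x∈K x∉K) (λ v∈A → contradiction v∈A v∉A)

colouringOnSides : ∀ {k ℓ n} (G : Graph n) (A : Subset n) → IsBipartition G A →
                   (L : ListAssignment k ℓ n) (K : Subset ℓ) →
                   (∀ v → Σ (Fin ℓ) λ x → x ∈ proj₁ L v × (x ∈ K ⇔ v ∈ A)) →
                   Σ (Fin n → Fin ℓ) λ c → ProperLColouring G L c
colouringOnSides {ℓ = ℓ} {n} G A (independentA , independentB) L K pick =
  c , (λ v → proj₁ (proj₂ (pick v))) , proper
  where
  c : Fin n → Fin ℓ
  c v = proj₁ (pick v)

  c∈K⇔ : ∀ v → c v ∈ K ⇔ v ∈ A
  c∈K⇔ v = proj₂ (proj₂ (pick v))

  proper : ∀ u v → Edge G u v → c u ≢ c v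
  proper u v uv cu≡cv with u ∈? A | v ∈? A
  ... | yes u∈A | yes v∈A = independentA u v uv u∈A v∈A
  ... | no  u∉A | no  v∉A = independentB u v uv u∉A v∉A
  ... | yes u∈A | no  v∉A =
    v∉A (Equivalence.to (c∈K⇔ v) (subst (_∈ K) cu≡cv (Equivalence.from (c∈K⇔ u) u∈A)))
  ... | no  u∉A | yes v∈A =
    u∉A (Equivalence.to (c∈K⇔ u) (subst (_∈ K) (sym cu≡cv) (Equivalence.from (c∈K⇔ v) v∈A)))

k∸1<k : ∀ {k} → 1 ≤ k → k ∸ 1 < k
k∸1<k (s≤s _) = ≤-refl

proposition4p1 : (k ℓ : ℕ) → 2 ≤ k → k ≤ ℓ → (n : ℕ) → (G : Graph n) → (A : Subset n)
    → IsBipartition G A → ∣ A ∣ <R[ k , ℓ ] → Choosable k ℓ G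
proposition4p1 k ℓ 2≤k _ n G A bipartite small L@(lists , ∣lists∣≡k) =
  let (K , ∣K∣≡k∸1 , K-meets) = transversal L A small
  in  colouringOnSides G A bipartite L K (coloursOnSides A L K K-meets λ v →
        subst₂ _<_ (sym ∣K∣≡k∸1) (sym (∣lists∣≡k v)) (k∸1<k (<⇒≤ 2≤k)))
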